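{- Let \(R(\eta)\) be an n-clause set refuted by a cycle. Then \(R(\eta)\) is refuted by a clause set cycle.
   Context: We work in many-sorted classical first-order logic with a sort \(\mathrm{nat}\) with \(\mathsf{0} : \mathrm{nat}\), \(\mathsf{s} : \mathrm{nat} \to \mathrm{nat}\); the language has at least one further sort and no other function symbols of range \(\mathrm{nat}\). \(\eta\) is a distinguished free variable of sort \(\mathrm{nat}\); \(\mathsf{s}^{i}t\) is \(i\)-fold application of \(\mathsf{s}\), and \(\overline{k} := \mathsf{s}^{k}\mathsf{0}\). A clause is a formula \(\forall \vec{y}\,\bigvee_{l} l_{l}\) with literals \(l_{l}\); a clause set is a finite conjunction of clauses. An n-clause is a clause \(\forall \vec{x}\,(N(\eta,\vec{x}) \vee C(\vec{x}))\) with \(N\) a disjunction of literals \(\eta \neq t(\vec{x})\) and \(C\) a disjunction of (in)equations between terms of sort other than \(\mathrm{nat}\); an n-clause set is a conjunction of n-clauses. For \(\mathcal{C} = \forall \vec{x}\,(\bigvee_{l=1}^{k}\eta \neq t_{l} \vee C)\), \(\mathcal{C}{\downarrow_{i}} := \forall \vec{x}\,(\bigvee_{l=1}^{k}\eta \neq \mathsf{s}^{i}(t_{l}) \vee C)\), extended conjunctively to n-clause sets. A triple \((i,j,S(\eta))\) with \(i,j \in \mathbb{N}\), \(j>0\), and \(S \subseteq R\) (a sub-conjunction of \(R\)) is a cycle for \(R\) if \(S \vdash \eta \neq \overline{k}\) for \(k = i,\dots,i+j-1\) and \(S \vdash S{\downarrow_{j}}\); \(R\) is refuted by a cycle if there is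 a cycle \((i,j,S)\) for \(R\) and \(R \vdash \eta \neq \overline{k}\) for \(k = 0,\dots,i-1\). A clause set \(S(\eta)\) is a clause set cycle if \(S(\mathsf{s}\eta) \models S(\eta)\) and \(S(\mathsf{0}) \models \bot\). A clause set \(R(\eta)\) is refuted by a clause set cycle \(S(\eta)\) if there is \(n \in \mathbb{N}\) with \(R(\mathsf{s}^{n}\eta) \models S(\eta)\) and \(R(\overline{k}) \models \bot\) for all \(k \in \{0,\dots,n-1\}\). -}

module Defs where

-- Semantic consequence ⊨ is Tarskian, over
-- all (normal, i.e. = interpreted as identity) structures.

open import Data.Nat using (ℕ; zero; suc; _<_; _≤_; _+_)
open import Data.Bool using (Bool; true; false)
open import Data.List using (List; []; _∷_; map)
open import Data.List.Membership.Propositional using (_∈_)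
open import Data.List.Relation.Unary.All as All using (All; []; _∷_)
open import Data.List.Relation.Binary.Sublist.Propositional using (_⊆_)
open import Data.Product using (Σ; _×_; _,_)
open import Data.Empty using (⊥)
open import Relation.Nullary using (¬_)
open import Relation.Binary.PropositionalEquality using (_≡_; _≢_)

record Signature : Set₁ where
  field
    Sort       : Set
    nat        : Sort
    -- function symbols other than 0, s ; none of them has range nat
    Fun        : Set
    dom        : Fun → List Sort
    cod        : Fun → Sort
    cod≢nat    : ∀ f → cod f ≢ nat
    Pred       : Set
    pdom       : Pred → List Sort
    otherSort  : Σ Sort (λ σ → σ ≢ nat)

module FOL (L : Signature) where
  open Signature L

  Ctx : Set
  Ctx = List Sort

  -- terms over bound variables Γ and the distinguished free variable η
  mutual
    data Term (Γ : Ctx) : Sort → Set where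
      var  : ∀ {σ} → σ ∈ Γ → Term Γ σ
      eta  : Term Γ nat
      zer  : Term Γ nat
      suc' : Term Γ nat → Term Γ nat
      app  : (f : Fun) → Args Γ (dom f) → Term Γ (cod f)

    data Args (Γ : Ctx) : List Sort → Set where
      []  : Args Γ []
      _∷_ : ∀ {σ σs} → Term Γ σ → Args Γ σs → Args Γ (σ ∷ σs)

  mutual
    data EtaFree {Γ : Ctx} : ∀ {σ} → Term Γ σ → Set where
      var  : ∀ {σ} (x : σ ∈ Γ) → EtaFree (var x)
      zer  : EtaFree zer
      suc' : ∀ {t} → EtaFree t → EtaFree (suc' t)
      app  : ∀ f {as} → EtaFreeArgs as → EtaFree (app f as)

    data EtaFreeArgs {Γ : Ctx} : ∀ {σs} → Args Γ σs → Set where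
      []  : EtaFreeArgs []
      _∷_ : ∀ {σ σs} {t : Term Γ σ} {as : Args Γ σs} →
            EtaFree t → EtaFreeArgs as → EtaFreeArgs (t ∷ as)

  sⁱ : ∀ {Γ} → ℕ → Term Γ nat → Term Γ nat
  sⁱ zero    t = t
  sⁱ (suc i) t = suc' (sⁱ i t)

  num : ∀ {Γ} → ℕ → Term Γ nat
  num k = sⁱ k zer

  mutual
    substη : ∀ {Γ σ} → (∀ {Δ} → Term Δ nat) → Term Γ σ → Term Γ σ
    substη u (var x)   = var x
    substη u eta       = u
    substη u zer       = zer
    substη u (suc' t)  = suc' (substη u t)
    substη u (app f as) = app f (substηArgs u as)

    substηArgs : ∀ {Γ σs} → (∀ {Δ} → Term Δ nat) → Args Γ σs → Args Γ σs
    substηArgs u []       = []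
    substηArgs u (t ∷ as) = substη u t ∷ substηArgs u as

  data Literal (Γ : Ctx) : Set where
    _≐_  : ∀ {σ} → Term Γ σ → Term Γ σ → Literal Γ
    _≠_  : ∀ {σ} → Term Γ σ → Term Γ σ → Literal Γ
    pos  : (p : Pred) → Args Γ (pdom p) → Literal Γ
    neg  : (p : Pred) → Args Γ (pdom p) → Literal Γ

  substηLit : ∀ {Γ} → (∀ {Δ} → Term Δ nat) → Literal Γ → Literal Γ
  substηLit u (t ≐ v)  = substη u t ≐ substη u v
  substηLit u (t ≠ v)  = substη u t ≠ substη u v
  substηLit u (pos p as) = pos p (substηArgs u as)
  substηLit u (neg p as) = neg p (substηArgs u as)

  -- a clause ∀ ȳ ⋁ literals  (only free variable: η)
  record Clause : Set where
    constructor ∀[_]_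
    field
      vars : Ctx
      lits : List (Literal vars)

  -- a clause set: finite conjunction of clauses
  ClauseSet : Set
  ClauseSet = List Clause

  substηC : (∀ {Δ} → Term Δ nat) → Clause → Clause
  substηC u (∀[ Γ ] ls) = ∀[ Γ ] map (substηLit u) ls

  _[η≔_] : ClauseSet → (∀ {Δ} → Term Δ nat) → ClauseSet
  S [η≔ u ] = map (substηC u) S

  ⊥ᶜ : ClauseSet
  ⊥ᶜ = (∀[ [] ] []) ∷ []

  η≠ : ℕ → ClauseSet
  η≠ k = (∀[ [] ] ((eta ≠ num k) ∷ [])) ∷ []

  record Structure : Set₁ where
    field
      Carrier : Sort → Set
      zeroI   : Carrier nat
      sucI    : Carrier nat → Carrier nat
      funI    : (f : Fun) → All Carrier (dom f) → Carrier (cod f)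
      predI   : (p : Pred) → All Carrier (pdom p) → Set

  module _ (M : Structure) (e : Structure.Carrier M nat) where
    open Structure M

    mutual
      ⟦_⟧ : ∀ {Γ σ} → Term Γ σ → All Carrier Γ → Carrier σ
      ⟦ var x ⟧    ρ = All.lookup ρ x
      ⟦ eta ⟧      ρ = e
      ⟦ zer ⟧      ρ = zeroI
      ⟦ suc' t ⟧   ρ = sucI (⟦ t ⟧ ρ)
      ⟦ app f as ⟧ ρ = funI f (⟦ as ⟧* ρ)

      ⟦_⟧* : ∀ {Γ σs} → Args Γ σs → All Carrier Γ → All Carrier σs
      ⟦ [] ⟧*     ρ = []
      ⟦ t ∷ as ⟧* ρ = ⟦ t ⟧ ρ ∷ ⟦ as ⟧* ρ

    LitFalse : ∀ {Γ} → All Carrier Γ → Literal Γ → Set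
    LitFalse ρ (t ≐ u)   = ¬ (⟦ t ⟧ ρ ≡ ⟦ u ⟧ ρ)
    LitFalse ρ (t ≠ u)   = ⟦ t ⟧ ρ ≡ ⟦ u ⟧ ρ
    LitFalse ρ (pos p as) = ¬ predI p (⟦ as ⟧* ρ)
    LitFalse ρ (neg p as) = predI p (⟦ as ⟧* ρ)

    ClauseTrue : Clause → Set
    ClauseTrue (∀[ Γ ] ls) = (ρ : All Carrier Γ) → ¬ All (LitFalse ρ) ls

    SetTrue : ClauseSet → Set
    SetTrue S = All ClauseTrue S

  _⊨_ : ClauseSet → ClauseSet → Set₁
  S ⊨ T = (M : Structure) (e : Structure.Carrier M nat) →
          SetTrue M e S → SetTrue M e T

  -- provability; by completeness of classical first-order logic
  -- identified with semantic consequence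
  _⊢_ : ClauseSet → ClauseSet → Set₁
  S ⊢ T = S ⊨ T

  record CLit (Γ : Ctx) : Set where
    field
      sort     : Sort
      sort≢nat : sort ≢ nat
      positive : Bool        -- true: t = u ; false: t ≠ u
      lhs rhs  : Term Γ sort
      lhsFree  : EtaFree lhs
      rhsFree  : EtaFree rhs

  CLit→Lit : ∀ {Γ} → CLit Γ → Literal Γ
  CLit→Lit c with CLit.positive c
  ... | true  = CLit.lhs c ≐ CLit.rhs c
  ... | false = CLit.lhs c ≠ CLit.rhs c

  -- ∀ x̄ (⋁_l η ≠ t_l(x̄) ∨ C(x̄))
  record NClause : Set where
    field
      vars   : Ctx
      N      : List (Term vars nat)
      NFree  : All EtaFree N
      C      : List (CLit vars)

  NClauseSet : Set
  NClauseSet = List NClause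

  _↓ₙ_ : NClause → ℕ → Clause
  c ↓ₙ i = ∀[ NClause.vars c ]
             (map (λ t → eta ≠ sⁱ i t) (NClause.N c) Data.List.++
              map CLit→Lit (NClause.C c))

  toClause : NClause → Clause
  toClause c = c ↓ₙ 0

  ⌜_⌝ : NClauseSet → ClauseSet
  ⌜ R ⌝ = map toClause R

  _↓_ : NClauseSet → ℕ → ClauseSet
  R ↓ i = map (λ c → c ↓ₙ i) R

  IsCycle : NClauseSet → ℕ → ℕ → NClauseSet → Set₁
  IsCycle R i j S =
    (0 < j) × (S ⊆ R) ×
    ((k : ℕ) → i ≤ k → k < i + j → ⌜ S ⌝ ⊢ η≠ k) ×
    (⌜ S ⌝ ⊢ (S ↓ j))

  RefutedByCycle : NClauseSet → Set₁
  RefutedByCycle R =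
    Σ ℕ λ i → Σ ℕ λ j → Σ NClauseSet λ S →
      IsCycle R i j S × ((k : ℕ) → k < i → ⌜ R ⌝ ⊢ η≠ k)

  IsClauseSetCycle : ClauseSet → Set₁
  IsClauseSetCycle S =
    ((S [η≔ suc' eta ]) ⊨ S) × ((S [η≔ zer ]) ⊨ ⊥ᶜ)

  RefutedByClauseSetCycle : ClauseSet → Set₁
  RefutedByClauseSetCycle R =
    Σ ClauseSet λ S → IsClauseSetCycle S ×
      Σ ℕ λ n → ((R [η≔ sⁱ n eta ]) ⊨ S) ×
                ((k : ℕ) → k < n → (R [η≔ num k ]) ⊨ ⊥ᶜ)

-- A cycle (i, j, S) yields the clause set cycle T(η) = S(sⁱη) ∨ S(sⁱ⁺¹η) ∨ … ∨ S(sⁱ⁺ʲ⁻¹η),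
-- made a clause set by distributing ∨ over ∧.  T(0̄) is refutable because S ⊢ η ≠ k̄ for
-- i ≤ k < i + j, and R(sⁱη) ⊨ T(η) because S ⊆ R.  For T(sη) ⊨ T(η), take a model where T(η)
-- fails, i.e. S fails at sⁱη, …, sⁱ⁺ʲ⁻¹η.  As T(sη) holds, S must hold at sⁱ⁺ʲη, hence so does
-- S↓j; but an assignment falsifying an n-clause of S at sⁱη falsifies its j-fold shift at sⁱ⁺ʲη.
-- A clause set is false exactly when one of its clauses has a falsifying assignment; the
-- argument manipulates such assignments and is therefore constructive.

module Submission where

open import Defs
open import Level using (Level)
open import Data.Nat using (ℕ; zero; suc; _<_; _≤_; _+_; z<s)
open import Data.Nat.Properties using (+-identityʳ; +-suc; +-comm; ≤-refl; <⇒≤; m<m+n)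
open import Data.Nat.GeneralisedArithmetic using (fold; fold-+)
open import Data.List using (List; []; _∷_; map; _++_; cartesianProductWith)
open import Data.List.Membership.Propositional using (_∈_)
open import Data.List.Membership.Propositional.Properties using (∈-++⁺ˡ; ∈-++⁺ʳ)
open import Data.List.Relation.Unary.All as All using (All; []; _∷_)
import Data.List.Relation.Unary.All.Properties as AllP
open import Data.List.Relation.Unary.Any as Any using (Any; here; there)
import Data.List.Relation.Unary.Any.Properties as AnyP
open import Data.List.Relation.Binary.Sublist.Propositional using (_⊆_)
import Data.List.Relation.Binary.Sublist.Propositional.Properties as SubP
open import Data.Product using (Σ; _×_; _,_; proj₁; map₂; curry; uncurry)
open import Data.Product.Function.NonDependent.Propositional using (_×-⇔_)
open import Data.Bool using (true; false)
open import Data.Unit using (⊤; tt)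
open import Data.Empty using (⊥; ⊥-elim)
open import Function using (_∘_; _⇔_; mk⇔; Equivalence)
open import Function.Construct.Identity using (⇔-id)
open import Function.Construct.Composition using (_⇔-∘_)
open import Relation.Nullary using (¬_)
open import Relation.Binary.PropositionalEquality
  using (_≡_; refl; sym; trans; cong; cong₂; subst; module ≡-Reasoning)

open Equivalence using (to; from)

private variable
  a b p q : Level
  A : Set a
  B : Set b

All-map⇔ : {P : B → Set p} {Q : A → Set q} {f : A → B} →
  (∀ {x} → P (f x) ⇔ Q x) → ∀ {xs} → All P (map f xs) ⇔ All Q xs
All-map⇔ h = mk⇔ (All.map (to h) ∘ AllP.map⁻) (AllP.map⁺ ∘ All.map (from h))

Any-map⇔ : {P : B → Set p} {Q : A → Set q} {f : A → B} →
  (∀ {x} → P (f x) ⇔ Q x) → ∀ {xs} → Any P (map f xs) ⇔ Any Q xs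
Any-map⇔ h = mk⇔ (Any.map (to h) ∘ AnyP.map⁻) (AnyP.map⁺ ∘ Any.map (from h))

module _ {P : A → Set p} {x : A} where

  lookup-++⁺ˡ : ∀ {xs ys} (pxs : All P xs) (pys : All P ys) (i : x ∈ xs) →
    All.lookup (AllP.++⁺ pxs pys) (∈-++⁺ˡ i) ≡ All.lookup pxs i
  lookup-++⁺ˡ (px ∷ pxs) pys (here refl) = refl
  lookup-++⁺ˡ (px ∷ pxs) pys (there i) = lookup-++⁺ˡ pxs pys i

  lookup-++⁺ʳ : ∀ {xs ys} (pxs : All P xs) (pys : All P ys) (i : x ∈ ys) →
    All.lookup (AllP.++⁺ pxs pys) (∈-++⁺ʳ xs i) ≡ All.lookup pys i
  lookup-++⁺ʳ [] pys i = refl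
  lookup-++⁺ʳ (px ∷ pxs) pys i = lookup-++⁺ʳ pxs pys i

  lookup-++⁻ˡ : ∀ xs {ys} (pxys : All P (xs ++ ys)) (i : x ∈ xs) →
    All.lookup pxys (∈-++⁺ˡ i) ≡ All.lookup (AllP.++⁻ˡ xs pxys) i
  lookup-++⁻ˡ (_ ∷ xs) (px ∷ pxys) (here refl) = refl
  lookup-++⁻ˡ (_ ∷ xs) (px ∷ pxys) (there i) = lookup-++⁻ˡ xs pxys i

  lookup-++⁻ʳ : ∀ xs {ys} (pxys : All P (xs ++ ys)) (i : x ∈ ys) →
    All.lookup pxys (∈-++⁺ʳ xs i) ≡ All.lookup (AllP.++⁻ʳ xs pxys) i
  lookup-++⁻ʳ [] pxys i = refl
  lookup-++⁻ʳ (_ ∷ xs) (px ∷ pxys) i = lookup-++⁻ʳ xs pxys i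

AllFrom : (ℕ → Set) → ℕ → ℕ → Set
AllFrom P k zero = ⊤
AllFrom P k (suc n) = P k × AllFrom P (suc k) n

module _ {P : ℕ → Set} where

  AllFrom-snoc : ∀ k n → AllFrom P k n → P (k + n) → AllFrom P k (suc n)
  AllFrom-snoc k zero tt pk = subst P (+-identityʳ k) pk , tt
  AllFrom-snoc k (suc n) (pk , ps) pk+n = pk , AllFrom-snoc (suc k) n ps (subst P (+-suc k n) pk+n)

  AllFrom-shift : {Q : ℕ → Set} → (∀ {l} → P (suc l) → Q l) →
    ∀ k n → AllFrom P (suc k) n → AllFrom Q k n
  AllFrom-shift f k zero tt = tt
  AllFrom-shift f k (suc n) (p , ps) = f p , AllFrom-shift f (suc k) n ps

  ¬¬-AllFrom : ∀ k n → (∀ l → k ≤ l → l < k + n → ¬ ¬ P l) → ¬ ¬ AllFrom P k n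
  ¬¬-AllFrom k zero h ¬ps = ¬ps tt
  ¬¬-AllFrom k (suc n) h ¬ps =
    h k ≤-refl (m<m+n k z<s) λ pk →
    ¬¬-AllFrom (suc k) n
      (λ l k<l l<k+n → h l (<⇒≤ k<l) (subst (l <_) (sym (+-suc k n)) l<k+n))
      (λ ps → ¬ps (pk , ps))

module ClauseSemantics (L : Signature) where
  open Signature L
  open FOL L

  Ren : Ctx → Ctx → Set
  Ren Γ Δ = ∀ {σ} → σ ∈ Γ → σ ∈ Δ

  mutual
    ren : ∀ {Γ Δ σ} → Ren Γ Δ → Term Γ σ → Term Δ σ
    ren f (var x) = var (f x)
    ren f eta = eta
    ren f zer = zer
    ren f (suc' t) = suc' (ren f t)
    ren f (app g as) = app g (renArgs f as)

    renArgs : ∀ {Γ Δ σs} → Ren Γ Δ → Args Γ σs → Args Δ σs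
    renArgs f [] = []
    renArgs f (t ∷ as) = ren f t ∷ renArgs f as

  mapLit : ∀ {Γ Δ} → (∀ {σ} → Term Γ σ → Term Δ σ) → (∀ {σs} → Args Γ σs → Args Δ σs) →
    Literal Γ → Literal Δ
  mapLit ft fa (t ≐ u) = ft t ≐ ft u
  mapLit ft fa (t ≠ u) = ft t ≠ ft u
  mapLit ft fa (pos p as) = pos p (fa as)
  mapLit ft fa (neg p as) = neg p (fa as)

  renLit : ∀ {Γ Δ} → Ren Γ Δ → Literal Γ → Literal Δ
  renLit f = mapLit (ren f) (renArgs f)

  substηLit≡mapLit : ∀ {Γ} (u : ∀ {Δ} → Term Δ nat) (l : Literal Γ) →
    substηLit u l ≡ mapLit (substη u) (substηArgs u) l
  substηLit≡mapLit u (t ≐ v) = refl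
  substηLit≡mapLit u (t ≠ v) = refl
  substηLit≡mapLit u (pos p as) = refl
  substηLit≡mapLit u (neg p as) = refl

  _⊔_ : Clause → Clause → Clause
  (∀[ Γ ] ls) ⊔ (∀[ Δ ] ms) =
    ∀[ Γ ++ Δ ] (map (renLit ∈-++⁺ˡ) ls ++ map (renLit (∈-++⁺ʳ Γ)) ms)

  -- the bound variables of the two clauses are kept apart by concatenating their contexts
  _∨ᶜ_ : ClauseSet → ClauseSet → ClauseSet
  _∨ᶜ_ = cartesianProductWith _⊔_

  ⋁-shifts : ClauseSet → ℕ → ℕ → ClauseSet
  ⋁-shifts T k zero = ⊥ᶜ
  ⋁-shifts T k (suc n) = (T [η≔ sⁱ k eta ]) ∨ᶜ ⋁-shifts T (suc k) n

  module _ (M : Structure) where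
    open Structure M

    ⟦sⁱ⟧ : ∀ {e Γ} k (t : Term Γ nat) (ρ : All Carrier Γ) →
      ⟦_⟧ M e (sⁱ k t) ρ ≡ fold (⟦_⟧ M e t ρ) sucI k
    ⟦sⁱ⟧ zero t ρ = refl
    ⟦sⁱ⟧ (suc k) t ρ = cong sucI (⟦sⁱ⟧ k t ρ)

    fold-sucI : ∀ v k → fold (sucI v) sucI k ≡ fold v sucI (suc k)
    fold-sucI v zero = refl
    fold-sucI v (suc k) = cong sucI (fold-sucI v k)

    Restricts : ∀ {Γ Δ} → Ren Γ Δ → All Carrier Δ → All Carrier Γ → Set
    Restricts f ρ′ ρ = ∀ {τ} (x : τ ∈ _) → All.lookup ρ′ (f x) ≡ All.lookup ρ x

    mutual
      ⟦ren⟧ : ∀ {e Γ Δ σ} (f : Ren Γ Δ) {ρ ρ′} → Restricts f ρ′ ρ →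
        (t : Term Γ σ) → ⟦_⟧ M e (ren f t) ρ′ ≡ ⟦_⟧ M e t ρ
      ⟦ren⟧ f h (var x) = h x
      ⟦ren⟧ f h eta = refl
      ⟦ren⟧ f h zer = refl
      ⟦ren⟧ f h (suc' t) = cong sucI (⟦ren⟧ f h t)
      ⟦ren⟧ f h (app g as) = cong (funI g) (⟦renArgs⟧ f h as)

      ⟦renArgs⟧ : ∀ {e Γ Δ σs} (f : Ren Γ Δ) {ρ ρ′} → Restricts f ρ′ ρ →
        (as : Args Γ σs) → ⟦_⟧* M e (renArgs f as) ρ′ ≡ ⟦_⟧* M e as ρ
      ⟦renArgs⟧ f h [] = refl
      ⟦renArgs⟧ f h (t ∷ as) = cong₂ _∷_ (⟦ren⟧ f h t) (⟦renArgs⟧ f h as)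

    module _ {e v : Carrier nat} {u : ∀ {Δ} → Term Δ nat}
             (⟦u⟧ : ∀ {Δ} (ρ : All Carrier Δ) → ⟦_⟧ M e (u {Δ}) ρ ≡ v) where
      mutual
        ⟦substη⟧ : ∀ {Γ σ} {ρ : All Carrier Γ} (t : Term Γ σ) →
          ⟦_⟧ M e (substη u t) ρ ≡ ⟦_⟧ M v t ρ
        ⟦substη⟧ (var x) = refl
        ⟦substη⟧ {ρ = ρ} eta = ⟦u⟧ ρ
        ⟦substη⟧ zer = refl
        ⟦substη⟧ (suc' t) = cong sucI (⟦substη⟧ t)
        ⟦substη⟧ (app g as) = cong (funI g) (⟦substηArgs⟧ as)

        ⟦substηArgs⟧ : ∀ {Γ σs} {ρ : All Carrier Γ} (as : Args Γ σs) →
          ⟦_⟧* M e (substηArgs u as) ρ ≡ ⟦_⟧* M v as ρ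
        ⟦substηArgs⟧ [] = refl
        ⟦substηArgs⟧ (t ∷ as) = cong₂ _∷_ (⟦substη⟧ t) (⟦substηArgs⟧ as)

    mutual
      ⟦⟧-etaFree : ∀ e e′ {Γ σ} {ρ : All Carrier Γ} {t : Term Γ σ} →
        EtaFree t → ⟦_⟧ M e t ρ ≡ ⟦_⟧ M e′ t ρ
      ⟦⟧-etaFree e e′ (var x) = refl
      ⟦⟧-etaFree e e′ zer = refl
      ⟦⟧-etaFree e e′ (suc' t) = cong sucI (⟦⟧-etaFree e e′ t)
      ⟦⟧-etaFree e e′ (app f as) = cong (funI f) (⟦⟧*-etaFree e e′ as)

      ⟦⟧*-etaFree : ∀ e e′ {Γ σs} {ρ : All Carrier Γ} {as : Args Γ σs} →
        EtaFreeArgs as → ⟦_⟧* M e as ρ ≡ ⟦_⟧* M e′ as ρ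
      ⟦⟧*-etaFree e e′ [] = refl
      ⟦⟧*-etaFree e e′ (t ∷ as) = cong₂ _∷_ (⟦⟧-etaFree e e′ t) (⟦⟧*-etaFree e e′ as)

    litFalse-mapLit : ∀ {e e′ Γ Δ} {ρ : All Carrier Γ} {ρ′ : All Carrier Δ}
      {ft : ∀ {σ} → Term Γ σ → Term Δ σ} {fa : ∀ {σs} → Args Γ σs → Args Δ σs} →
      (∀ {σ} (t : Term Γ σ) → ⟦_⟧ M e′ (ft t) ρ′ ≡ ⟦_⟧ M e t ρ) →
      (∀ {σs} (as : Args Γ σs) → ⟦_⟧* M e′ (fa as) ρ′ ≡ ⟦_⟧* M e as ρ) →
      (l : Literal Γ) → LitFalse M e′ ρ′ (mapLit ft fa l) ⇔ LitFalse M e ρ l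
    litFalse-mapLit ht ha (t ≐ u) rewrite ht t | ht u = ⇔-id _
    litFalse-mapLit ht ha (t ≠ u) rewrite ht t | ht u = ⇔-id _
    litFalse-mapLit ht ha (pos p as) rewrite ha as = ⇔-id _
    litFalse-mapLit ht ha (neg p as) rewrite ha as = ⇔-id _

    cLitFalse-η : ∀ {e e′ Γ} {ρ : All Carrier Γ} (c : CLit Γ) →
      LitFalse M e ρ (CLit→Lit c) → LitFalse M e′ ρ (CLit→Lit c)
    cLitFalse-η {e} {e′} record { positive = true ; lhsFree = l ; rhsFree = r } t≢u t≡u =
      t≢u (trans (⟦⟧-etaFree e e′ l) (trans t≡u (sym (⟦⟧-etaFree e e′ r))))
    cLitFalse-η {e} {e′} record { positive = false ; lhsFree = l ; rhsFree = r } t≡u =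
      trans (sym (⟦⟧-etaFree e e′ l)) (trans t≡u (⟦⟧-etaFree e e′ r))

    ClauseFalsified : Carrier nat → Clause → Set
    ClauseFalsified e (∀[ Γ ] ls) = Σ (All Carrier Γ) λ ρ → All (LitFalse M e ρ) ls

    Falsified : Carrier nat → ClauseSet → Set
    Falsified e = Any (ClauseFalsified e)

    clauseTrue⇔¬falsified : ∀ {e} c → ClauseTrue M e c ⇔ (¬ ClauseFalsified e c)
    clauseTrue⇔¬falsified (∀[ Γ ] ls) = mk⇔ uncurry curry

    setTrue⇔¬falsified : ∀ {e} {T : ClauseSet} → SetTrue M e T ⇔ (¬ Falsified e T)
    setTrue⇔¬falsified {T = T} = mk⇔
      (AllP.All¬⇒¬Any ∘ All.map (to (clauseTrue⇔¬falsified _)))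
      (All.map (from (clauseTrue⇔¬falsified _)) ∘ AllP.¬Any⇒All¬ T)

    module _ {e v : Carrier nat} {u : ∀ {Δ} → Term Δ nat}
             (⟦u⟧ : ∀ {Δ} (ρ : All Carrier Δ) → ⟦_⟧ M e (u {Δ}) ρ ≡ v) where

      clauseFalsified-substη : ∀ c → ClauseFalsified e (substηC u c) ⇔ ClauseFalsified v c
      clauseFalsified-substη (∀[ Γ ] ls) = mk⇔ (map₂ (to allFalse)) (map₂ (from allFalse))
        where
          litFalse : ∀ {ρ} l → LitFalse M e ρ (substηLit u l) ⇔ LitFalse M v ρ l
          litFalse l rewrite substηLit≡mapLit u l =
            litFalse-mapLit (⟦substη⟧ ⟦u⟧) (⟦substηArgs⟧ ⟦u⟧) l
          allFalse : ∀ {ρ} → All (LitFalse M e ρ) (map (substηLit u) ls) ⇔ All (LitFalse M v ρ) ls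
          allFalse = All-map⇔ λ {l} → litFalse l

      falsified-[η≔] : ∀ T → Falsified e (T [η≔ u ]) ⇔ Falsified v T
      falsified-[η≔] T = Any-map⇔ λ {c} → clauseFalsified-substη c

      setTrue-[η≔] : ∀ T → SetTrue M e (T [η≔ u ]) → SetTrue M v T
      setTrue-[η≔] T t = from setTrue⇔¬falsified
        (to setTrue⇔¬falsified t ∘ from (falsified-[η≔] T))

    allFalse-renLit : ∀ {e Γ Δ} {f : Ren Γ Δ} {ρ ρ′} → Restricts f ρ′ ρ → ∀ ls →
      All (LitFalse M e ρ′) (map (renLit f) ls) ⇔ All (LitFalse M e ρ) ls
    allFalse-renLit {f = f} h ls = All-map⇔ λ {l} → litFalse-mapLit (⟦ren⟧ f h) (⟦renArgs⟧ f h) l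

    clauseFalsified-⊔ : ∀ {e} c d →
      ClauseFalsified e (c ⊔ d) ⇔ (ClauseFalsified e c × ClauseFalsified e d)
    clauseFalsified-⊔ {e} c@(∀[ Γ ] ls) d@(∀[ Δ ] ms) = mk⇔ split join
      where
        split : ClauseFalsified e (c ⊔ d) → ClauseFalsified e c × ClauseFalsified e d
        split (ρ , f) =
          (AllP.++⁻ˡ Γ ρ , to (allFalse-renLit (lookup-++⁻ˡ Γ ρ) ls) (AllP.++⁻ˡ _ f)) ,
          (AllP.++⁻ʳ Γ ρ , to (allFalse-renLit (lookup-++⁻ʳ Γ ρ) ms) (AllP.++⁻ʳ _ f))
        join : ClauseFalsified e c × ClauseFalsified e d → ClauseFalsified e (c ⊔ d)
        join ((ρ , f) , (ρ′ , f′)) =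
          AllP.++⁺ ρ ρ′ ,
          AllP.++⁺ (from (allFalse-renLit (lookup-++⁺ˡ ρ ρ′) ls) f)
                   (from (allFalse-renLit (lookup-++⁺ʳ ρ ρ′) ms) f′)

    falsified-∨ᶜ : ∀ {e} T U → Falsified e (T ∨ᶜ U) ⇔ (Falsified e T × Falsified e U)
    falsified-∨ᶜ T U = mk⇔
      (AnyP.cartesianProductWith⁻ _⊔_ (to (clauseFalsified-⊔ _ _)) T U)
      (uncurry (AnyP.cartesianProductWith⁺ _⊔_ λ c d → from (clauseFalsified-⊔ _ _) (c , d)))

    falsified-⋁-shifts : ∀ {e} T k n →
      Falsified e (⋁-shifts T k n) ⇔ AllFrom (λ l → Falsified (fold e sucI l) T) k n
    falsified-⋁-shifts T k zero = mk⇔ (λ _ → tt) (λ _ → here ([] , []))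
    falsified-⋁-shifts T k (suc n) =
      (falsified-[η≔] (⟦sⁱ⟧ k eta) T ×-⇔ falsified-⋁-shifts T (suc k) n) ⇔-∘ falsified-∨ᶜ _ _

    litFalse-η≠-shift : ∀ {y Γ} {ρ : All Carrier Γ} j {t : Term Γ nat} → EtaFree t →
      LitFalse M y ρ (eta ≠ t) → LitFalse M (fold y sucI j) ρ (eta ≠ sⁱ j t)
    litFalse-η≠-shift {y} {ρ = ρ} j {t} free y≡t = begin
      fold y sucI j                                ≡⟨ cong (λ x → fold x sucI j) y≡t ⟩
      fold (⟦_⟧ M y t ρ) sucI j                     ≡⟨ cong (λ x → fold x sucI j) (⟦⟧-etaFree y y′ free) ⟩
      fold (⟦_⟧ M y′ t ρ) sucI j                    ≡⟨ sym (⟦sⁱ⟧ j t ρ) ⟩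
      ⟦_⟧ M y′ (sⁱ j t) ρ                          ∎
      where
        open ≡-Reasoning
        y′ : Carrier nat
        y′ = fold y sucI j

    clauseFalsified-↓ : ∀ {y} j c →
      ClauseFalsified y (toClause c) → ClauseFalsified (fold y sucI j) (c ↓ₙ j)
    clauseFalsified-↓ {y} j c (ρ , f) =
      ρ , AllP.++⁺
            (AllP.map⁺ (All.zipWith (uncurry (litFalse-η≠-shift j)) (NClause.NFree c , AllP.map⁻ nPart)))
            (AllP.map⁺ (All.map (λ {l} → cLitFalse-η l) (AllP.map⁻ cPart)))
      where
        nPart : All (LitFalse M y ρ) (map (eta ≠_) (NClause.N c))
        nPart = AllP.++⁻ˡ _ f
        cPart : All (LitFalse M y ρ) (map CLit→Lit (NClause.C c))
        cPart = AllP.++⁻ʳ (map (eta ≠_) (NClause.N c)) f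

    falsified-↓ : ∀ {y} j (S : NClauseSet) → Falsified y ⌜ S ⌝ → Falsified (fold y sucI j) (S ↓ j)
    falsified-↓ j S = AnyP.map⁺ ∘ Any.map (λ {c} → clauseFalsified-↓ j c) ∘ AnyP.map⁻

    η≠-false : ∀ k → ¬ SetTrue M (fold zeroI sucI k) (η≠ k)
    η≠-false k (t ∷ []) = t [] (sym (⟦sⁱ⟧ k zer []) ∷ [])

  open Structure

  ⊆⇒⊨ : ∀ {T U} → T ⊆ U → U ⊨ T
  ⊆⇒⊨ T⊆U M e = SubP.All-resp-⊆ T⊆U

  η≠-refutes : ∀ T k → T ⊨ η≠ k → (T [η≔ num k ]) ⊨ ⊥ᶜ
  η≠-refutes T k T⊨η≠k M e t =
    ⊥-elim (η≠-false M k (T⊨η≠k M _ (setTrue-[η≔] M (⟦sⁱ⟧ M k zer) T t)))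

  ⋁-shifts-intro : ∀ T U i n → U ⊨ T → (U [η≔ sⁱ i eta ]) ⊨ ⋁-shifts T i (suc n)
  ⋁-shifts-intro T U i n U⊨T M e u = from (setTrue⇔¬falsified M) λ w →
    to (setTrue⇔¬falsified M) T-true (proj₁ (to (falsified-⋁-shifts M T i (suc n)) w))
    where
      T-true : SetTrue M (fold e (sucI M) i) T
      T-true = U⊨T M _ (setTrue-[η≔] M (⟦sⁱ⟧ M i eta) U u)

  ⋁-shifts-base : ∀ T i j → (∀ k → i ≤ k → k < i + j → T ⊨ η≠ k) →
    (⋁-shifts T i j [η≔ zer ]) ⊨ ⊥ᶜ
  ⋁-shifts-base T i j T⊨η≠ M e t = ⊥-elim (¬¬-AllFrom i j falsifiedAt ¬all)
    where
      ¬all : ¬ AllFrom (λ l → Falsified M (fold (zeroI M) (sucI M) l) T) i j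
      ¬all = to (setTrue⇔¬falsified M) (setTrue-[η≔] M (λ ρ → refl) (⋁-shifts T i j) t)
           ∘ from (falsified-⋁-shifts M T i j)
      falsifiedAt : ∀ k → i ≤ k → k < i + j → ¬ ¬ Falsified M (fold (zeroI M) (sucI M) k) T
      falsifiedAt k i≤k k<i+j ¬w =
        η≠-false M k (T⊨η≠ k i≤k k<i+j M _ (from (setTrue⇔¬falsified M) ¬w))

  ⋁-shifts-step : ∀ (S : NClauseSet) i m → ⌜ S ⌝ ⊨ (S ↓ suc m) →
    (⋁-shifts ⌜ S ⌝ i (suc m) [η≔ suc' eta ]) ⊨ ⋁-shifts ⌜ S ⌝ i (suc m)
  ⋁-shifts-step S i m step M e t =
    from (setTrue⇔¬falsified M) (¬window-falsified ∘ to (falsified-⋁-shifts M ⌜ S ⌝ i (suc m)))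
    where
      open ≡-Reasoning
      F : Carrier M nat → ℕ → Set
      F v l = Falsified M (fold v (sucI M) l) ⌜ S ⌝
      x : Carrier M nat
      x = fold e (sucI M) (suc i + m)
      ¬falsified-at-sucI : ¬ AllFrom (F (sucI M e)) i (suc m)
      ¬falsified-at-sucI =
        to (setTrue⇔¬falsified M) (setTrue-[η≔] M (λ ρ → refl) (⋁-shifts ⌜ S ⌝ i (suc m)) t)
        ∘ from (falsified-⋁-shifts M ⌜ S ⌝ i (suc m))
      shift-origin : ∀ {l} → F e (suc l) → F (sucI M e) l
      shift-origin {l} = subst (λ v → Falsified M v ⌜ S ⌝) (sym (fold-sucI M e l))
      -- a falsifying assignment at sⁱ⁺ʲe would move the falsified window one step up, to s e
      S-true-at-x : AllFrom (F e) (suc i) m → SetTrue M x ⌜ S ⌝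
      S-true-at-x ws = from (setTrue⇔¬falsified M) λ wₓ →
        ¬falsified-at-sucI
          (AllFrom-shift (λ {l} → shift-origin {l}) i (suc m) (AllFrom-snoc (suc i) m ws wₓ))
      x≡ : fold (fold e (sucI M) i) (sucI M) (suc m) ≡ x
      x≡ = begin
        fold (fold e (sucI M) i) (sucI M) (suc m) ≡⟨ sym (fold-+ e (sucI M) (suc m)) ⟩
        fold e (sucI M) (suc m + i)               ≡⟨ cong (λ n → fold e (sucI M) (suc n)) (+-comm m i) ⟩
        x                                         ∎
      ¬window-falsified : F e i × AllFrom (F e) (suc i) m → ⊥
      ¬window-falsified (wᵢ , ws) = to (setTrue⇔¬falsified M) (step M x (S-true-at-x ws))
        (subst (λ v → Falsified M v (S ↓ suc m)) x≡ (falsified-↓ M (suc m) S wᵢ))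

proposition5p5 : (L : Signature) (R : FOL.NClauseSet L) →
    FOL.RefutedByCycle L R → FOL.RefutedByClauseSetCycle L (FOL.⌜_⌝ L R)
proposition5p5 L R (i , zero , S , (() , _) , _)
proposition5p5 L R (i , suc m , S , (_ , S⊆R , S⊢η≠ , S⊢S↓) , R⊢η≠) =
  ⋁-shifts ⌜ S ⌝ i (suc m) ,
  (⋁-shifts-step S i m S⊢S↓ , ⋁-shifts-base ⌜ S ⌝ i (suc m) S⊢η≠) ,
  i , ⋁-shifts-intro ⌜ S ⌝ ⌜ R ⌝ i m (⊆⇒⊨ (SubP.map⁺ toClause S⊆R)) ,
  λ k k<i → η≠-refutes ⌜ R ⌝ k (R⊢η≠ k k<i)
  where
    open FOL L
    open ClauseSemantics L
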